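{- Let $G$ be a $2$-edge connected graph of diameter $4$ and let $pq$ be an edge of $G$ that lies in no cycle of length $3$ or $4$. Let $\vec{H_1}$ be the oriented subgraph of $G$ returned by the algorithm OrientedCore (described in the context) on input $G$, $pq$. Then the diameter of $\vec{H_1}$ is at most $17$. Moreover, for every $w\in V(\vec{H_1})$: if $w\in S_{1,2}$ then $d_{\vec{H_1}}(p,w)\le 1$, $d_{\vec{H_1}}(w,q)\le 7$; if $w\in S_{2,3}$ then $d_{\vec{H_1}}(p,w)\le 2$, $d_{\vec{H_1}}(w,q)\le 6$; if $w\in S_{3,4}$ then $d_{\vec{H_1}}(p,w)\le 3$, $d_{\vec{H_1}}(w,q)\le 5$; if $w\in S_{2,2}$ then $d_{\vec{H_1}}(p,w)\le 2$, $d_{\vec{H_1}}(w,q)\le 2$; if $w\in S_{3,3}$ then $d_{\vec{H_1}}(p,w)\le 5$, $d_{\vec{H_1}}(w,q)\le 5$; if $w\in S_{4,4}$ then $d_{\vec{H_1}}(p,w)\le 6$, $d_{\vec{H_1}}(w,q)\le 4$; if $w\in S_{2,1}$ then $d_{\vec{H_1}}(p,w)\le 9$, $d_{\vec{H_1}}(w,q)\le 1$; if $w\in S_{3,2}$ then $d_{\vec{H_1}}(p,w)\le 8$, $d_{\vec{H_1}}(w,q)\le 2$; if $w\in S_{4,3}$ then $d_{\vec{H_1}}(p,w)\le 7$, $d_{\vec{H_1}}(w,q)\le 3$.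
   Context: For integers $i,j$ let $S_{i,j}=\{v\in V(G): d_G(v,p)=i,\ d_G(v,q)=j\}$. For $v\in S_{i,j}$ its level is $L(v)=j-i\in\{1,0,-1\}$ and its width is $W(v)=\max(i,j)$. An edge between vertices lying in different sets $S_{i,j}$ is written $uv$ when either $L(u)>L(v)$ (then it is called vertical) or $L(u)=L(v)$ and $W(u)<W(v)$ (horizontal). Algorithm OrientedCore builds an oriented subgraph $\vec{H}$ (shortest paths below are in $G$): Stage 1: start with $\vec{H}$ empty. For each vertical edge $uv$ with $L(u)=1$, $L(v)\in\{0,-1\}$, and for each shortest $p$–$u$ path $P_u$ and each shortest $v$–$q$ path $P_v$, orient the $p$–$q$ path formed by $P_u$, $uv$, $P_v$ as a directed path from $p$ to $q$ and add it to $\vec{H}$. Stage 2: for each vertical edge $uv$ with $L(u)=0$, $L(v)=-1$ not already oriented in Stage 1, and for each shortest $p$–$u$ path $P_u$ and shortest $v$–$q$ path $P_v$: let $x$ be the last vertex of $P_u$ (nearest to $u$) already in $V(\vec{H})$ and $P_u'$ the subpath from $x$ to $u$; let $y$ be the first vertex of $P_v$ (nearest to $v$) already in $V(\vec{H})$ and $P_v'$ the subpath from $v$ to $y$; orient the $x$–$y$ path formed by $P_u'$, $uv$, $P_v'$ from $x$ to $y$ and add it to $\vec{H}$. (These orientations never conflict.) Stage 3: orient $pq$ from $q$ to $p$ and add it to $\vec{H}$. The output is $\vec{H}$ (here called $\vec{H_1}$). $d_{\vec{H_1}}(x,y)$ is the length of a shortest directed $x$–$y$ path in $\vec{H_1}$;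 the diameter of $\vec{H_1}$ is the maximum of $d_{\vec{H_1}}(x,y)$ over $x,y\in V(\vec{H_1})$. -}

module Defs where

open import Data.Nat using (ℕ; zero; suc; _≤_)
open import Data.Fin using (Fin)
open import Data.Bool using (Bool; true; false)
open import Data.Integer using (ℤ; +_; _-_; _<_; 0ℤ; 1ℤ; -1ℤ)
open import Data.List using (List; []; _∷_; _++_; length)
open import Data.List.Relation.Unary.All using (All)
open import Data.List.Membership.Propositional using (_∈_)
open import Data.Product using (Σ; _×_; _,_; ∃; ∃-syntax)
open import Data.Sum using (_⊎_)
open import Relation.Nullary using (¬_)
open import Relation.Binary.PropositionalEquality using (_≡_; _≢_)

record Graph : Set where
  field
    n       : ℕ
    adj     : Fin n → Fin n → Bool
    adj-sym : ∀ x y → adj x y ≡ adj y x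
    adj-irr : ∀ x → adj x x ≡ false

module _ (G : Graph) where
  open Graph G

  Vertex : Set
  Vertex = Fin n

  Adj : Vertex → Vertex → Set
  Adj x y = adj x y ≡ true

-- Walks along an arbitrary relation R:  WalkL R x ys z  says that
-- x ∷ ys is the vertex sequence of a walk from x to z, each consecutive
-- pair being related by R.  Its length (number of steps) is length ys.

data WalkL {V : Set} (R : V → V → Set) : V → List V → V → Set where
  done : ∀ {x} → WalkL R x [] x
  step : ∀ {x y ys z} → R x y → WalkL R y ys z → WalkL R x (y ∷ ys) z

data Consec {V : Set} : List V → V → V → Set where
  here  : ∀ {x y zs} → Consec (x ∷ y ∷ zs) x y
  there : ∀ {z zs x y} → Consec zs x y → Consec (z ∷ zs) x y

Connected : {V : Set} → (V → V → Set) → Set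
Connected {V} R = ∀ (x y : V) → Σ (List V) λ ys → WalkL R x ys y

module _ (G : Graph) where

  Dist : Vertex G → Vertex G → ℕ → Set
  Dist x y k =
    (Σ (List (Vertex G)) λ ys → WalkL (Adj G) x ys y × length ys ≡ k)
    × (∀ ys → WalkL (Adj G) x ys y → k ≤ length ys)

  ShortestPath : Vertex G → List (Vertex G) → Vertex G → Set
  ShortestPath x ys y = WalkL (Adj G) x ys y × Dist x y (length ys)

  Diameter : ℕ → Set
  Diameter d =
    (∀ x y → Σ ℕ λ k → Dist x y k × k ≤ d)
    × (Σ (Vertex G) λ x → Σ (Vertex G) λ y → Dist x y d)

  AdjMinus : Vertex G → Vertex G → Vertex G → Vertex G → Set
  AdjMinus a b x y = Adj G x y × ¬ ((x ≡ a × y ≡ b) ⊎ (x ≡ b × y ≡ a))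

  TwoEdgeConnected : Set
  TwoEdgeConnected =
    Connected (Adj G) × (∀ a b → Adj G a b → Connected (AdjMinus a b))

  EdgeInC3 : Vertex G → Vertex G → Set
  EdgeInC3 p q = Σ (Vertex G) λ w → Adj G q w × Adj G w p

  -- the edge pq lies in a cycle of length 4  (p, q, x, y pairwise distinct;
  -- the remaining distinctness conditions follow from irreflexivity)
  EdgeInC4 : Vertex G → Vertex G → Set
  EdgeInC4 p q = Σ (Vertex G) λ x → Σ (Vertex G) λ y →
    Adj G q x × Adj G x y × Adj G y p × x ≢ p × y ≢ q

module OrientedCore (G : Graph) (p q : Vertex G) where

  V : Set
  V = Vertex G

  Arcs : Set₁
  Arcs = V → V → Set

  InS : ℕ → ℕ → V → Set
  InS i j v = Dist G v p i × Dist G v q j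

  HasLevel : V → ℤ → Set
  HasLevel v l = Σ ℕ λ i → Σ ℕ λ j → InS i j v × (+ j) - (+ i) ≡ l

  Vertical : V → V → Set
  Vertical u v = Adj G u v ×
    (Σ ℤ λ lu → Σ ℤ λ lv → HasLevel u lu × HasLevel v lv × lv < lu)

  Stage1 : Arcs
  Stage1 a b = Σ V λ u → Σ V λ v → Σ (List V) λ us → Σ (List V) λ vs →
    Vertical u v × HasLevel u 1ℤ × (HasLevel v 0ℤ ⊎ HasLevel v -1ℤ)
    × ShortestPath G p us u × ShortestPath G v vs q
    × Consec ((p ∷ us) ++ (v ∷ vs)) a b

  VH : Arcs → V → Set
  VH H x = Σ V λ y → H x y ⊎ H y x

  -- Stage 2 candidates: (u, v, P_u, P_v) with P_u = p ∷ us, P_v = v ∷ vs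
  record Cand : Set where
    constructor cand
    field
      cu  : V
      cv  : V
      cus : List V
      cvs : List V

  Qualifying : Cand → Set
  Qualifying (cand u v us vs) =
    Vertical u v × HasLevel u 0ℤ × HasLevel v -1ℤ
    × ¬ Stage1 u v × ¬ Stage1 v u
    × ShortestPath G p us u × ShortestPath G v vs q

  -- seg is the x–y path  P_u', uv, P_v'  built from candidate c w.r.t. H:
  -- x is the last vertex of P_u in V(H), y the first vertex of P_v in V(H)
  Segment : Arcs → Cand → List V → Set
  Segment H (cand u v us vs) seg =
    Σ (List V) λ A → Σ V λ x → Σ (List V) λ B →
    Σ (List V) λ C → Σ V λ y → Σ (List V) λ D →
      (p ∷ us) ≡ A ++ (x ∷ B) × VH H x × All (λ w → ¬ VH H w) B
      × (v ∷ vs) ≡ C ++ (y ∷ D) × VH H y × All (λ w → ¬ VH H w) C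
      × seg ≡ x ∷ (B ++ (C ++ (y ∷ [])))

  data Run2 : Arcs → List Cand → Arcs → Set₁ where
    run-nil  : ∀ {H} → Run2 H [] H
    run-cons : ∀ {H c cs H' seg} → Segment H c seg →
               Run2 (λ a b → H a b ⊎ Consec seg a b) cs H' →
               Run2 H (c ∷ cs) H'

  -- the list cs enumerates (all and only) the Stage-2 candidates,
  -- in an arbitrary order
  Enumerates : List Cand → Set
  Enumerates cs = All Qualifying cs × (∀ c → Qualifying c → c ∈ cs)

  Stage3 : Arcs → Arcs
  Stage3 H a b = (H a b × ¬ (a ≡ p × b ≡ q)) ⊎ (a ≡ q × b ≡ p)

DDistLe : {V : Set} → (V → V → Set) → V → V → ℕ → Set
DDistLe {V} H x y k = Σ (List V) λ ys → WalkL H x ys y × length ys ≤ k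

-- For every vertex w of the oriented graph built so far we keep directed walks p ⇝ w and
-- w ⇝ q avoiding the arc p → q, of lengths bounded by a budget depending on the class
-- S_{i,j} of w: (i, 8 − i) if L(w) = 1, (i + 2, 8 − i) if L(w) = 0, and (10 − j, j) if
-- L(w) = −1.  The level never increases along the shortest paths P_u and P_v, so vertices
-- of P_u are measured from p and those of P_v towards q.  A Stage-1 path P_u, uv, P_v has
-- length at most 3 + 1 + 4 = 8, and the path P_u, uv, P_v behind a Stage-2 segment at most
-- 4 + 1 + 3 = 8; a Stage-2 segment only extends walks that already exist at its endpoints
-- x ∈ P_u and y ∈ P_v, costing the slack 2 of the level-0 budget.  Since pq lies in no
-- triangle, S_{1,1} is empty, and S_{2,2} is reached by a Stage-1 path p a w b q.
-- 2-edge-connectivity yields a Stage-1 path avoiding pq, which bounds p and q themselves.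
-- Then x ≠ p reaches q within 7 and p reaches y ≠ q within 9, so through the reversed arc
-- q → p the diameter is at most 7 + 1 + 9 = 17.

module Submission where

open import Defs
open import Data.Nat using (ℕ; zero; suc; _+_; _∸_; _≤_; z≤n; s≤s)
open import Data.Nat.Properties
open import Data.Nat.Tactic.RingSolver using (solve-∀)
import Data.Fin.Properties as Fin
open import Data.List using (List; []; _∷_; _++_; length)
open import Data.List.Properties using (length-++; ++-assoc; ∷-injective)
open import Data.List.Relation.Unary.All using (All; []; _∷_)
open import Data.Product using (Σ; _×_; _,_; proj₁; proj₂)
open import Data.Sum using (_⊎_; inj₁; inj₂; [_,_])
open import Data.Empty using (⊥; ⊥-elim)
open import Relation.Nullary using (¬_; Dec; yes; no)
open import Relation.Binary.Core using (_⇒_)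
open import Relation.Binary.PropositionalEquality
  using (_≡_; _≢_; refl; sym; trans; cong; cong₂; subst; subst₂; module ≡-Reasoning)
open import Data.Integer as ℤ using (_⊖_; -_; 0ℤ; 1ℤ; -1ℤ; +<+; -<+)
import Data.Integer.Properties as ℤₚ

m⊖n≡+k⇒m≡k+n : ∀ m n k → m ⊖ n ≡ ℤ.+ k → m ≡ k + n
m⊖n≡+k⇒m≡k+n m       zero    k refl = sym (+-identityʳ m)
m⊖n≡+k⇒m≡k+n zero    (suc n) k ()
m⊖n≡+k⇒m≡k+n (suc m) (suc n) k e =
  trans (cong suc (m⊖n≡+k⇒m≡k+n m n k (trans (sym (ℤₚ.[1+m]⊖[1+n]≡m⊖n m n)) e))) (sym (+-suc k n))

1+n⊖n≡1 : ∀ n → suc n ⊖ n ≡ 1ℤ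
1+n⊖n≡1 zero    = refl
1+n⊖n≡1 (suc n) = trans (ℤₚ.[1+m]⊖[1+n]≡m⊖n (suc n) n) (1+n⊖n≡1 n)

module _ {V : Set} where

  walk-++ : ∀ {R : V → V → Set} {x ys y zs z} → WalkL R x ys y → WalkL R y zs z → WalkL R x (ys ++ zs) z
  walk-++ done       w′ = w′
  walk-++ (step r w) w′ = step r (walk-++ w w′)

  walk-map : ∀ {R S : V → V → Set} → R ⇒ S → ∀ {x ys y} → WalkL R x ys y → WalkL S x ys y
  walk-map f done       = done
  walk-map f (step r w) = step (f r) (walk-map f w)

  walk-consec : ∀ {R S : V → V → Set} {x ys z} → WalkL R x ys z →
                (∀ {a b} → Consec (x ∷ ys) a b → S a b) → WalkL S x ys z
  walk-consec done       f = done
  walk-consec (step r w) f = step (f here) (walk-consec w (λ c → f (there c)))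

  walk-split : ∀ {R : V → V → Set} {x ys z} → WalkL R x ys z → ∀ A w B → x ∷ ys ≡ A ++ w ∷ B →
               (Σ (List V) λ zs → WalkL R x zs w × length zs ≡ length A) × WalkL R w B z
  walk-split w          []            u B refl = ([] , done , refl) , w
  walk-split (step r w) (a ∷ [])      u B refl = (u ∷ [] , step r done , refl) , w
  walk-split (step r w) (a ∷ a′ ∷ A) u B refl with walk-split w (a′ ∷ A) u B refl
  ... | (zs , w₁ , l) , w₂ = (_ ∷ zs , step r w₁ , cong suc l) , w₂

  walk-take : ∀ {R : V → V → Set} C {x y D z} → WalkL R x (C ++ y ∷ D) z → WalkL R x (C ++ y ∷ []) y
  walk-take []      (step r w) = step r done
  walk-take (c ∷ C) (step r w) = step r (walk-take C w)

  walk-cons-take : ∀ {R : V → V → Set} {t x ys z} → R t x → WalkL R x ys z →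
                   ∀ C y D → x ∷ ys ≡ C ++ y ∷ D → WalkL R t (C ++ y ∷ []) y
  walk-cons-take r w []      y D refl = step r done
  walk-cons-take r w (c ∷ C) y D e with ∷-injective e
  ... | refl , refl = step r (walk-take C w)

  consec-split : ∀ {L : List V} {a b} → Consec L a b → Σ (List V) λ A → Σ (List V) λ B → L ≡ A ++ a ∷ b ∷ B
  consec-split (here {zs = zs}) = [] , zs , refl
  consec-split (there {z = z} c) with consec-split c
  ... | A , B , e = z ∷ A , B , cong (z ∷_) e

  consec-target : ∀ {L : List V} {a b} → Consec L a b → Σ (List V) λ A → Σ (List V) λ B → L ≡ A ++ b ∷ B
  consec-target c with consec-split c
  ... | A , B , e = A ++ _ ∷ [] , B , trans e (sym (++-assoc A (_ ∷ []) (_ ∷ B)))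

  consec-occurrence : ∀ {L : List V} {a b} → Consec L a b ⊎ Consec L b a →
                      Σ (List V) λ A → Σ (List V) λ B → L ≡ A ++ a ∷ B
  consec-occurrence (inj₁ c) with consec-split c
  ... | A , B , e = A , _ ∷ B , e
  consec-occurrence (inj₂ c) = consec-target c

  consec-++ˡ : ∀ (A : List V) {L a b} → Consec L a b → Consec (A ++ L) a b
  consec-++ˡ []      c = c
  consec-++ˡ (x ∷ A) c = there (consec-++ˡ A c)

  consec-++ʳ : ∀ {L : List V} (D : List V) {a b} → Consec L a b → Consec (L ++ D) a b
  consec-++ʳ D here      = here
  consec-++ʳ D (there c) = there (consec-++ʳ D c)

  consec-++⁻ : ∀ (X Y : List V) {a b} → Consec (X ++ Y) a b →
    Consec X a b ⊎ Consec Y a b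
    ⊎ ((Σ (List V) λ X₀ → X ≡ X₀ ++ a ∷ []) × (Σ (List V) λ Y₀ → Y ≡ b ∷ Y₀))
  consec-++⁻ []            Y         c         = inj₂ (inj₁ c)
  consec-++⁻ (x ∷ [])      []        (there ())
  consec-++⁻ (x ∷ [])      (y ∷ Y)   here      = inj₂ (inj₂ (([] , refl) , (Y , refl)))
  consec-++⁻ (x ∷ [])      Y         (there c) = inj₂ (inj₁ c)
  consec-++⁻ (x ∷ x′ ∷ X) Y         here      = inj₁ here
  consec-++⁻ (x ∷ x′ ∷ X) Y         (there c) with consec-++⁻ (x′ ∷ X) Y c
  ... | inj₁ c′                       = inj₁ (there c′)
  ... | inj₂ (inj₁ c′)                = inj₂ (inj₁ c′)
  ... | inj₂ (inj₂ ((X₀ , e) , r))    = inj₂ (inj₂ ((x ∷ X₀ , cong (x ∷_) e) , r))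

  ++-split : ∀ (X Y A : List V) w B → X ++ Y ≡ A ++ w ∷ B →
      (Σ (List V) λ A₂ → X ≡ A ++ w ∷ A₂ × B ≡ A₂ ++ Y)
    ⊎ (Σ (List V) λ B₁ → Y ≡ B₁ ++ w ∷ B × A ≡ X ++ B₁)
  ++-split []      Y A       w B e = inj₂ (A , e , refl)
  ++-split (x ∷ X) Y []      w B e with ∷-injective e
  ... | refl , e₂ = inj₁ (X , refl , sym e₂)
  ++-split (x ∷ X) Y (a ∷ A) w B e with ∷-injective e
  ... | refl , e₂ with ++-split X Y A w B e₂
  ... | inj₁ (A₂ , e₃ , e₄) = inj₁ (A₂ , cong (x ∷_) e₃ , e₄)
  ... | inj₂ (B₁ , e₃ , e₄) = inj₂ (B₁ , e₃ , cong (x ∷_) e₄)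

  length-split : ∀ (x : V) ys A w B → x ∷ ys ≡ A ++ w ∷ B → length ys ≡ length A + length B
  length-split x ys A w B e =
    suc-injective (trans (cong length e) (trans (length-++ A) (+-suc (length A) (length B))))

  module _ {H : V → V → Set} where

    DDistLe-walk : ∀ {x ys y k} → WalkL H x ys y → length ys ≤ k → DDistLe H x y k
    DDistLe-walk w l = _ , w , l

    DDistLe-refl : ∀ {x} → DDistLe H x x 0
    DDistLe-refl = [] , done , z≤n

    DDistLe-weaken : ∀ {x y k k′} → k ≤ k′ → DDistLe H x y k → DDistLe H x y k′
    DDistLe-weaken le (ys , w , l) = ys , w , ≤-trans l le

    DDistLe-trans : ∀ {x y z k l} → DDistLe H x y k → DDistLe H y z l → DDistLe H x z (k + l)
    DDistLe-trans (ys , w , l) (zs , w′ , l′) =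
      ys ++ zs , walk-++ w w′ , subst (_≤ _) (sym (length-++ ys)) (+-mono-≤ l l′)

    DDistLe-mono : ∀ {H′ : V → V → Set} → H ⇒ H′ → ∀ {x y k} → DDistLe H x y k → DDistLe H′ x y k
    DDistLe-mono f (ys , w , l) = ys , walk-map f w , l

module Metric (G : Graph) (dist : ∀ x y → Σ ℕ (Dist G x y)) where
  open Graph G using (adj-sym; adj-irr)

  private
    V : Set
    V = Vertex G

  Walk : V → List V → V → Set
  Walk = WalkL (Adj G)

  d : V → V → ℕ
  d x y = proj₁ (dist x y)

  geodesic : ∀ x y → Σ (List V) λ ys → Walk x ys y × length ys ≡ d x y
  geodesic x y = proj₁ (proj₂ (dist x y))

  d≤length : ∀ {x ys y} → Walk x ys y → d x y ≤ length ys
  d≤length {x} {ys} {y} w = proj₂ (proj₂ (dist x y)) ys w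

  Dist⇒≡d : ∀ {x y k} → Dist G x y k → k ≡ d x y
  Dist⇒≡d {x} {y} ((ys , w , l) , minimal) with geodesic x y
  ... | ys₀ , w₀ , l₀ = ≤-antisym (subst (_ ≤_) l₀ (minimal ys₀ w₀)) (subst (d x y ≤_) l (d≤length w))

  Adj-sym : ∀ {x y} → Adj G x y → Adj G y x
  Adj-sym {x} {y} a = trans (adj-sym y x) a

  walk-reverse : ∀ {x ys y} → Walk x ys y → Σ (List V) λ zs → Walk y zs x × length zs ≡ length ys
  walk-reverse done = [] , done , refl
  walk-reverse {x} (step a w) with walk-reverse w
  ... | zs , w′ , l = zs ++ x ∷ [] , walk-++ w′ (step (Adj-sym a) done) ,
                      trans (length-++ zs) (trans (+-comm (length zs) 1) (cong suc l))

  d-sym : ∀ x y → d x y ≡ d y x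
  d-sym x y = ≤-antisym (≤-sym x y) (≤-sym y x)
    where
      ≤-sym : ∀ x y → d x y ≤ d y x
      ≤-sym x y with geodesic y x
      ... | ys , w , l with walk-reverse w
      ... | zs , w′ , l′ = subst (d x y ≤_) (trans l′ l) (d≤length w′)

  d-triangle : ∀ x y z → d x z ≤ d x y + d y z
  d-triangle x y z with geodesic x y | geodesic y z
  ... | ys , w , l | zs , w′ , l′ =
    subst (d x z ≤_) (trans (length-++ ys) (cong₂ _+_ l l′)) (d≤length (walk-++ w w′))

  d-adj : ∀ {x y} → Adj G x y → d x y ≤ 1
  d-adj a = d≤length (step a done)

  d-refl : ∀ x → d x x ≡ 0
  d-refl x = n≤0⇒n≡0 (d≤length {x} {[]} {x} done)

  d≡0⇒≡ : ∀ {x y} → d x y ≡ 0 → x ≡ y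
  d≡0⇒≡ {x} {y} e with geodesic x y
  ... | []    , done , l = refl
  ... | _ ∷ _ , w    , l = ⊥-elim (0≢1+n (trans (sym e) (sym l)))

  ≢⇒d≥1 : ∀ {x y} → x ≢ y → 1 ≤ d x y
  ≢⇒d≥1 x≢y = n≢0⇒n>0 (λ e → x≢y (d≡0⇒≡ e))

  d≡1⇒Adj : ∀ {x y} → d x y ≡ 1 → Adj G x y
  d≡1⇒Adj {x} {y} e with geodesic x y
  ... | []         , w                , l = ⊥-elim (0≢1+n (trans l e))
  ... | _ ∷ []     , step a done      , l = a
  ... | _ ∷ _ ∷ _ , w                , l = ⊥-elim (0≢1+n (sym (suc-injective (trans l e))))

  d≡2⇒middle : ∀ {x y} → d x y ≡ 2 → Σ V λ z → Adj G x z × Adj G z y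
  d≡2⇒middle {x} {y} e with geodesic x y
  ... | _ ∷ _ ∷ []     , step a (step b done) , _ = _ , a , b
  ... | []             , _ , l = ⊥-elim (0≢1+n (trans l e))
  ... | _ ∷ []         , _ , l = ⊥-elim (0≢1+n (suc-injective (trans l e)))
  ... | _ ∷ _ ∷ _ ∷ _ , _ , l = ⊥-elim (1+n≢0 (suc-injective (suc-injective (trans l e))))

  Adj⇒≢ : ∀ {x y} → Adj G x y → x ≢ y
  Adj⇒≢ {x} a refl with trans (sym (adj-irr x)) a
  ... | ()

  d-adj-step : ∀ z {x y} → Adj G x y → d y z ≤ suc (d x z)
  d-adj-step z {x} {y} a = ≤-trans (d-triangle y x z) (+-monoˡ-≤ (d x z) (d-adj (Adj-sym a)))

  d-middle : ∀ {x y z} → Adj G x y → Adj G y z → d x z ≡ 2 → d y z ≡ 1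
  d-middle {x} {y} {z} a₁ a₂ e = ≤-antisym (d-adj a₂)
    (+-cancelˡ-≤ 1 1 (d y z) (subst (_≤ 1 + d y z) e (≤-trans (d-triangle x y z) (+-monoˡ-≤ (d y z) (d-adj a₁)))))

  ShortestPath-length : ∀ {x ys y} → ShortestPath G x ys y → length ys ≡ d x y
  ShortestPath-length (_ , D) = Dist⇒≡d D

  walk⇒ShortestPath : ∀ {x y} ys → Walk x ys y → length ys ≡ d x y → ShortestPath G x ys y
  walk⇒ShortestPath {x} {y} ys w l = w , subst (Dist G x y) (sym l) (proj₂ (dist x y))

  ShortestPath-split : ∀ {x ys y} → ShortestPath G x ys y → ∀ A w B → x ∷ ys ≡ A ++ w ∷ B →
                       d x w ≡ length A × d w y ≡ length B
  ShortestPath-split {x} {ys} {y} sp A w B e with walk-split (proj₁ sp) A w B e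
  ... | (zs , w₁ , l₁) , w₂ = tight (subst (d x w ≤_) l₁ (d≤length w₁)) (d≤length w₂) total
    where
      total : length A + length B ≤ d x w + d w y
      total = subst (_≤ d x w + d w y) (trans (sym (ShortestPath-length sp)) (length-split x ys A w B e))
                    (d-triangle x w y)
      tight : ∀ {a b m n} → a ≤ m → b ≤ n → m + n ≤ a + b → a ≡ m × b ≡ n
      tight {a} {b} {m} {n} a≤m b≤n s =
        ≤-antisym a≤m (+-cancelʳ-≤ n m a (≤-trans s (+-monoʳ-≤ a b≤n))) ,
        ≤-antisym b≤n (+-cancelˡ-≤ m n b (≤-trans s (+-monoˡ-≤ b a≤m)))

module Levels (G : Graph) (dist : ∀ x y → Σ ℕ (Dist G x y)) (p q : Vertex G) (pq : Adj G p q) where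
  open Metric G dist
  open OrientedCore G p q using (V; InS; HasLevel)

  dp dq : V → ℕ
  dp w = d w p
  dq w = d w q

  dp-p : dp p ≡ 0
  dp-p = d-refl p

  dq-q : dq q ≡ 0
  dq-q = d-refl q

  dq-p : dq p ≡ 1
  dq-p with d p q in e | d-adj pq
  ... | zero     | _       = ⊥-elim (Adj⇒≢ pq (d≡0⇒≡ e))
  ... | suc zero | _       = refl
  ... | suc (suc _) | s≤s ()

  dp-q : dp q ≡ 1
  dp-q = trans (d-sym q p) dq-p

  dp≤1+dq : ∀ w → dp w ≤ suc (dq w)
  dp≤1+dq w = ≤-trans (d-triangle w q p) (≤-reflexive (trans (cong (dq w +_) dp-q) (+-comm (dq w) 1)))

  dq≤1+dp : ∀ w → dq w ≤ suc (dp w)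
  dq≤1+dp w = ≤-trans (d-triangle w p q) (≤-reflexive (trans (cong (dp w +_) dq-p) (+-comm (dp w) 1)))

  data Level (i j : ℕ) : Set where
    ascending  : j ≡ suc i → Level i j
    flat       : j ≡ i → Level i j
    descending : i ≡ suc j → Level i j

  private
    n≢2+n : ∀ {n} → n ≢ suc (suc n)
    n≢2+n {n} = <⇒≢ (m<n⇒m<1+n (n<1+n n))

  Level-irrelevant : ∀ {i j} (l l′ : Level i j) → l ≡ l′
  Level-irrelevant (ascending e)  (ascending e′)  = cong ascending (≡-irrelevant e e′)
  Level-irrelevant (flat e)       (flat e′)       = cong flat (≡-irrelevant e e′)
  Level-irrelevant (descending e) (descending e′) = cong descending (≡-irrelevant e e′)
  Level-irrelevant (ascending e)  (flat e′)       = ⊥-elim (1+n≢n (trans (sym e) e′))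
  Level-irrelevant (ascending e)  (descending e′) = ⊥-elim (n≢2+n (trans e (cong suc e′)))
  Level-irrelevant (flat e)       (ascending e′)  = ⊥-elim (1+n≢n (trans (sym e′) e))
  Level-irrelevant (flat e)       (descending e′) = ⊥-elim (1+n≢n (trans (sym e′) (sym e)))
  Level-irrelevant (descending e) (ascending e′)  = ⊥-elim (n≢2+n (trans e′ (cong suc e)))
  Level-irrelevant (descending e) (flat e′)       = ⊥-elim (1+n≢n (trans (sym e) (sym e′)))

  level-of : ∀ i j → i ≤ suc j → j ≤ suc i → Level i j
  level-of zero          zero          _       _       = flat refl
  level-of zero          (suc zero)    _       _       = ascending refl
  level-of zero          (suc (suc j)) _       (s≤s ())
  level-of (suc zero)    zero          _       _       = descending refl
  level-of (suc (suc i)) zero          (s≤s ()) _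
  level-of (suc i)       (suc j)       (s≤s a) (s≤s b) with level-of i j a b
  ... | ascending e  = ascending (cong suc e)
  ... | flat e       = flat (cong suc e)
  ... | descending e = descending (cong suc e)

  level : ∀ w → Level (dp w) (dq w)
  level w = level-of (dp w) (dq w) (dp≤1+dq w) (dq≤1+dp w)

  InS⇒≡ : ∀ {i j w} → InS i j w → i ≡ dp w × j ≡ dq w
  InS⇒≡ (D₁ , D₂) = Dist⇒≡d D₁ , Dist⇒≡d D₂

  HasLevel⇒⊖ : ∀ {v l} → HasLevel v l → dq v ⊖ dp v ≡ l
  HasLevel⇒⊖ (i , j , s , e) with InS⇒≡ s
  ... | refl , refl = trans (sym (ℤₚ.[+m]-[+n]≡m⊖n j i)) e

  ⊖⇒HasLevel : ∀ {v l} → dq v ⊖ dp v ≡ l → HasLevel v l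
  ⊖⇒HasLevel {v} e =
    dp v , dq v , (proj₂ (dist v p) , proj₂ (dist v q)) , trans (ℤₚ.[+m]-[+n]≡m⊖n (dq v) (dp v)) e

  HasLevel-ascending : ∀ {v} → HasLevel v 1ℤ → dq v ≡ suc (dp v)
  HasLevel-ascending h = m⊖n≡+k⇒m≡k+n _ _ 1 (HasLevel⇒⊖ h)

  HasLevel-flat : ∀ {v} → HasLevel v 0ℤ → dq v ≡ dp v
  HasLevel-flat h = m⊖n≡+k⇒m≡k+n _ _ 0 (HasLevel⇒⊖ h)

  HasLevel-descending : ∀ {v} → HasLevel v -1ℤ → dp v ≡ suc (dq v)
  HasLevel-descending {v} h = m⊖n≡+k⇒m≡k+n _ _ 1 (trans (ℤₚ.⊖-swap (dp v) (dq v)) (cong -_ (HasLevel⇒⊖ h)))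

  ascending⇒HasLevel : ∀ {v} → dq v ≡ suc (dp v) → HasLevel v 1ℤ
  ascending⇒HasLevel {v} e = ⊖⇒HasLevel (trans (cong (_⊖ dp v) e) (1+n⊖n≡1 (dp v)))

  flat⇒HasLevel : ∀ {v} → dq v ≡ dp v → HasLevel v 0ℤ
  flat⇒HasLevel {v} e = ⊖⇒HasLevel (trans (cong (_⊖ dp v) e) (ℤₚ.n⊖n≡0 (dp v)))

  descending⇒HasLevel : ∀ {v} → dp v ≡ suc (dq v) → HasLevel v -1ℤ
  descending⇒HasLevel {v} e =
    ⊖⇒HasLevel (trans (cong (dq v ⊖_) e) (trans (ℤₚ.⊖-swap (dq v) (suc (dq v))) (cong -_ (1+n⊖n≡1 (dq v)))))

  geodesic-from-p : ∀ {us u} → ShortestPath G p us u → ∀ A w B → p ∷ us ≡ A ++ w ∷ B →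
                    length A ≡ dp w × dp w + length B ≡ dp u × dq u ≤ dq w + length B
  geodesic-from-p {us} {u} sp A w B e with ShortestPath-split sp A w B e
  ... | dpw , dwu = lA , dpu , dqu
    where
      lA : length A ≡ dp w
      lA = trans (sym dpw) (d-sym p w)
      dpu : dp w + length B ≡ dp u
      dpu = trans (cong (_+ length B) (sym lA))
                  (trans (sym (length-split p us A w B e)) (trans (ShortestPath-length sp) (d-sym p u)))
      dqu : dq u ≤ dq w + length B
      dqu = subst (λ k → dq u ≤ k) (trans (cong (_+ dq w) (trans (d-sym u w) dwu)) (+-comm (length B) (dq w)))
                  (d-triangle u w q)

  geodesic-to-q : ∀ {v vs} → ShortestPath G v vs q → ∀ C w D → v ∷ vs ≡ C ++ w ∷ D →
                  length D ≡ dq w × length C + dq w ≡ dq v × dp v ≤ length C + dp w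
  geodesic-to-q {v} {vs} sp C w D e with ShortestPath-split sp C w D e
  ... | dvw , dwq = sym dwq ,
                    trans (cong (length C +_) dwq) (trans (sym (length-split v vs C w D e)) (ShortestPath-length sp)) ,
                    subst (λ k → dp v ≤ k + dp w) dvw (d-triangle v w p)

  prefix-nondescending : ∀ {us u} → ShortestPath G p us u → dp u ≤ dq u →
                         ∀ A w B → p ∷ us ≡ A ++ w ∷ B → dp w ≤ dq w
  prefix-nondescending sp u≤ A w B e with geodesic-from-p sp A w B e
  ... | _ , dpu , dqu = +-cancelʳ-≤ (length B) (dp w) (dq w) (≤-trans (≤-reflexive dpu) (≤-trans u≤ dqu))

  prefix-ascending : ∀ {us u} → ShortestPath G p us u → dq u ≡ suc (dp u) →
                     ∀ A w B → p ∷ us ≡ A ++ w ∷ B → dq w ≡ suc (dp w)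
  prefix-ascending sp u↑ A w B e with geodesic-from-p sp A w B e
  ... | _ , dpu , dqu = ≤-antisym (dq≤1+dp w)
    (+-cancelʳ-≤ (length B) (suc (dp w)) (dq w)
      (≤-trans (s≤s (≤-reflexive dpu)) (≤-trans (≤-reflexive (sym u↑)) dqu)))

  suffix-nonascending : ∀ {v vs} → ShortestPath G v vs q → dq v ≤ dp v →
                        ∀ C w D → v ∷ vs ≡ C ++ w ∷ D → dq w ≤ dp w
  suffix-nonascending sp v≤ C w D e with geodesic-to-q sp C w D e
  ... | _ , dqv , dpv = +-cancelˡ-≤ (length C) (dq w) (dp w) (≤-trans (≤-reflexive dqv) (≤-trans v≤ dpv))

  suffix-descending : ∀ {v vs} → ShortestPath G v vs q → dp v ≡ suc (dq v) →
                      ∀ C w D → v ∷ vs ≡ C ++ w ∷ D → dp w ≡ suc (dq w)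
  suffix-descending sp v↓ C w D e with geodesic-to-q sp C w D e
  ... | _ , dqv , dpv = ≤-antisym (dp≤1+dq w)
    (+-cancelˡ-≤ (length C) (suc (dq w)) (dp w)
      (≤-trans (≤-reflexive (trans (+-suc (length C) (dq w)) (cong suc dqv))) (≤-trans (≤-reflexive (sym v↓)) dpv)))

  geodesic-end : ∀ {us u} → ShortestPath G p us u → ∀ X a → p ∷ us ≡ X ++ a ∷ [] → a ≡ u
  geodesic-end sp X a e = d≡0⇒≡ (proj₂ (ShortestPath-split sp X a [] e))

  pq-arc⇒middle : ∀ {us u v vs} → ShortestPath G p us u → dp u ≤ dq u →
                  ShortestPath G v vs q → dq v ≤ dp v →
                  Consec ((p ∷ us) ++ (v ∷ vs)) p q → u ≡ p × v ≡ q
  pq-arc⇒middle {us} {u} {v} {vs} spu u≤ spv v≤ c with consec-++⁻ (p ∷ us) (v ∷ vs) c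
  ... | inj₁ c′ with consec-target c′
  ...   | A , B , e = ⊥-elim (1+n≰n (subst₂ _≤_ dp-q dq-q (prefix-nondescending spu u≤ A q B e)))
  pq-arc⇒middle spu u≤ spv v≤ c | inj₂ (inj₁ c′) with consec-split c′
  ...   | C , D , e = ⊥-elim (1+n≰n (subst₂ _≤_ dq-p dp-p (suffix-nonascending spv v≤ C p (q ∷ D) e)))
  pq-arc⇒middle spu u≤ spv v≤ c | inj₂ (inj₂ ((X₀ , e₀) , (Y₀ , e₁))) =
    sym (geodesic-end spu X₀ p e₀) , proj₁ (∷-injective e₁)

module CoreBounds (G : Graph) (p q : Vertex G) (two-edge-connected : TwoEdgeConnected G) (diam : Diameter G 4)
                 (pq : Adj G p q) (no-C3 : ¬ EdgeInC3 G p q) where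

  dist : ∀ x y → Σ ℕ (Dist G x y)
  dist x y = proj₁ (proj₁ diam x y) , proj₁ (proj₂ (proj₁ diam x y))

  open Metric G dist
  open Levels G dist p q pq
  open OrientedCore G p q

  d≤4 : ∀ x y → d x y ≤ 4
  d≤4 x y = proj₂ (proj₂ (proj₁ diam x y))

  -- Stage 3 deletes the arc p → q, so all bounds are realised by walks avoiding it.
  WithoutPQ : Arcs → Arcs
  WithoutPQ H a b = H a b × ¬ (a ≡ p × b ≡ q)

  ReachWithin : Arcs → V → V → ℕ → Set
  ReachWithin H = DDistLe (WithoutPQ H)

  ReachWithin-mono : ∀ {H H′} → H ⇒ H′ → ∀ {x y k} → ReachWithin H x y k → ReachWithin H′ x y k
  ReachWithin-mono f = DDistLe-mono (λ (h , ¬pq) → f h , ¬pq)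

  fromP-budget toQ-budget : ∀ {i j} → Level i j → ℕ
  fromP-budget {i}     (ascending _)  = i
  fromP-budget {i}     (flat _)       = i + 2
  fromP-budget {j = j} (descending _) = 10 ∸ j
  toQ-budget {i}     (ascending _)  = 8 ∸ i
  toQ-budget {i}     (flat _)       = 8 ∸ i
  toQ-budget {j = j} (descending _) = j

  Bounds : Arcs → (w : V) → Level (dp w) (dq w) → Set
  Bounds H w l = ReachWithin H p w (fromP-budget l) × ReachWithin H w q (toQ-budget l)

  Bounded : Arcs → V → Set
  Bounded H w = ∀ l → Bounds H w l

  bounded : ∀ {H w} l → Bounds H w l → Bounded H w
  bounded {H} {w} l b l′ = subst (Bounds H w) (Level-irrelevant l l′) b

  Bounded-mono : ∀ {H H′} → H ⇒ H′ → ∀ {w} → Bounded H w → Bounded H′ w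
  Bounded-mono f b l = ReachWithin-mono f (proj₁ (b l)) , ReachWithin-mono f (proj₂ (b l))

  module _ {H : Arcs} {w : V} where

    ascending-bounds : ∀ {b} (e : dq w ≡ suc (dp w)) → ReachWithin H p w (dp w) → ReachWithin H w q b →
                       b + dp w ≤ 8 → Bounds H w (ascending e)
    ascending-bounds e p⇝w w⇝q le = p⇝w , DDistLe-weaken (m+n≤o⇒m≤o∸n _ le) w⇝q

    flat-bounds : ∀ {a b} (e : dq w ≡ dp w) → ReachWithin H p w a → ReachWithin H w q b →
                  a ≤ dp w + 2 → b + dp w ≤ 8 → Bounds H w (flat e)
    flat-bounds e p⇝w w⇝q a≤ le = DDistLe-weaken a≤ p⇝w , DDistLe-weaken (m+n≤o⇒m≤o∸n _ le) w⇝q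

    descending-bounds : ∀ {a} (e : dp w ≡ suc (dq w)) → ReachWithin H p w (a + 2) → ReachWithin H w q (dq w) →
                        a + dq w ≤ 8 → Bounds H w (descending e)
    descending-bounds {a} e p⇝w w⇝q le =
      DDistLe-weaken (m+n≤o⇒m≤o∸n (a + 2) (subst (_≤ 10) swap (+-monoˡ-≤ 2 le))) p⇝w , w⇝q
      where
        swap : a + dq w + 2 ≡ a + 2 + dq w
        swap = trans (+-assoc a (dq w) 2) (trans (cong (a +_) (+-comm (dq w) 2)) (sym (+-assoc a 2 (dq w))))

  S₀₀-empty : ∀ {w} → dp w ≡ 0 → dq w ≡ 0 → ⊥
  S₀₀-empty e₁ e₂ = Adj⇒≢ pq (trans (sym (d≡0⇒≡ e₁)) (d≡0⇒≡ e₂))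

  S₁₁-empty : ∀ {w} → dp w ≡ 1 → dq w ≡ 1 → ⊥
  S₁₁-empty {w} e₁ e₂ = no-C3 (w , Adj-sym (d≡1⇒Adj e₂) , d≡1⇒Adj e₁)

  flat⇒2⊎≥3 : ∀ {w} → dq w ≡ dp w → dp w ≡ 2 ⊎ 3 ≤ dp w
  flat⇒2⊎≥3 {w} e with dp w in eq
  ... | 0                 = ⊥-elim (S₀₀-empty eq e)
  ... | 1                 = ⊥-elim (S₁₁-empty eq e)
  ... | 2                 = inj₁ refl
  ... | suc (suc (suc _)) = inj₂ (s≤s (s≤s (s≤s z≤n)))

  flat-bounds-≥3 : ∀ {H w a} (e : dq w ≡ dp w) → 3 ≤ dp w → ReachWithin H p w a → ReachWithin H w q (dq w) →
                   a + dq w ≤ 8 → Bounds H w (flat e)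
  flat-bounds-≥3 {w = w} {a} e w≥3 p⇝w w⇝q le = flat-bounds e p⇝w w⇝q a≤ (+-mono-≤ (d≤4 w q) (d≤4 w p))
    where
      a≤ : a ≤ dp w + 2
      a≤ = ≤-trans (+-cancelʳ-≤ 3 a 5 (≤-trans (+-monoʳ-≤ a (subst (3 ≤_) (sym e) w≥3)) le))
                   (+-monoˡ-≤ 2 w≥3)

  module Stage1Path {u v : V} {us vs : List V} (vertical : Vertical u v) (u-level : HasLevel u 1ℤ)
                    (v-level : HasLevel v 0ℤ ⊎ HasLevel v -1ℤ)
                    (P-u : ShortestPath G p us u) (P-v : ShortestPath G v vs q) where

    path : List V
    path = (p ∷ us) ++ (v ∷ vs)

    u-ascending : dq u ≡ suc (dp u)
    u-ascending = HasLevel-ascending u-level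

    u-nondescending : dp u ≤ dq u
    u-nondescending = subst (dp u ≤_) (sym u-ascending) (n≤1+n (dp u))

    v-nonascending : dq v ≤ dp v
    v-nonascending = nonascending v-level
      where
        nonascending : HasLevel v 0ℤ ⊎ HasLevel v -1ℤ → dq v ≤ dp v
        nonascending (inj₁ h) = ≤-reflexive (HasLevel-flat h)
        nonascending (inj₂ h) = subst (dq v ≤_) (sym (HasLevel-descending h)) (n≤1+n (dq v))

    path-length : length (us ++ v ∷ vs) ≤ 8
    path-length = subst (_≤ 8) (sym (length-++ us)) (+-mono-≤ us≤3 (s≤s vs≤4))
      where
        us≤3 : length us ≤ 3
        us≤3 = subst (_≤ 3) (sym (trans (ShortestPath-length P-u) (d-sym p u)))
                     (≤-pred (subst (_≤ 4) u-ascending (d≤4 u q)))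
        vs≤4 : length vs ≤ 4
        vs≤4 = subst (_≤ 4) (sym (ShortestPath-length P-v)) (d≤4 v q)

    walk : ¬ (u ≡ p × v ≡ q) → WalkL (WithoutPQ Stage1) p (us ++ v ∷ vs) q
    walk uv≢pq = walk-consec (walk-++ (proj₁ P-u) (step (proj₁ vertical) (proj₁ P-v)))
      λ c → (u , v , us , vs , vertical , u-level , v-level , P-u , P-v , c) ,
            λ (a≡p , b≡q) → uv≢pq (pq-arc⇒middle P-u u-nondescending P-v v-nonascending
                                                  (subst₂ (Consec path) a≡p b≡q c))

    degenerate-vertex : u ≡ p → v ≡ q → ∀ A w B → path ≡ A ++ w ∷ B → w ≡ p ⊎ w ≡ q
    degenerate-vertex u≡p v≡q A w B e with ++-split (p ∷ us) (v ∷ vs) A w B e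
    ... | inj₁ (A₂ , e₁ , _) = inj₁ (d≡0⇒≡ (m+n≡0⇒m≡0 (dp w)
            (trans (proj₁ (proj₂ (geodesic-from-p P-u A w A₂ e₁))) (trans (cong dp u≡p) dp-p))))
    ... | inj₂ (B₁ , e₁ , _) = inj₂ (d≡0⇒≡ (m+n≡0⇒n≡0 (length B₁)
            (trans (proj₁ (proj₂ (geodesic-to-q P-v B₁ w B e₁))) (trans (cong dq v≡q) dq-q))))

    bounded-on-path : ¬ (u ≡ p × v ≡ q) → (∀ {w} → dp w ≡ 2 → dq w ≡ 2 → Bounded Stage1 w) →
                      ∀ A w B → path ≡ A ++ w ∷ B → Bounded Stage1 w
    bounded-on-path uv≢pq S₂₂ A w B e with walk-split (walk uv≢pq) A w B e
    ... | (_ , walk-pw , lA) , walk-wq = on-side (++-split (p ∷ us) (v ∷ vs) A w B e)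
      where
        p⇝w : ReachWithin Stage1 p w (length A)
        p⇝w = DDistLe-walk walk-pw (≤-reflexive lA)
        w⇝q : ReachWithin Stage1 w q (length B)
        w⇝q = DDistLe-walk walk-wq ≤-refl
        total : length A + length B ≤ 8
        total = subst (_≤ 8) (length-split p (us ++ v ∷ vs) A w B e) path-length

        on-side : (Σ (List V) λ A₂ → p ∷ us ≡ A ++ w ∷ A₂ × B ≡ A₂ ++ v ∷ vs)
                ⊎ (Σ (List V) λ B₁ → v ∷ vs ≡ B₁ ++ w ∷ B × A ≡ (p ∷ us) ++ B₁) → Bounded Stage1 w
        on-side (inj₁ (A₂ , e₁ , _)) =
          bounded (ascending w↑) (ascending-bounds w↑ (subst (ReachWithin Stage1 p w) lA≡ p⇝w) w⇝q
                                   (subst (_≤ 8) (trans (+-comm (length A) (length B)) (cong (length B +_) lA≡)) total))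
          where
            w↑ : dq w ≡ suc (dp w)
            w↑ = prefix-ascending P-u u-ascending A w A₂ e₁
            lA≡ : length A ≡ dp w
            lA≡ = proj₁ (geodesic-from-p P-u A w A₂ e₁)
        on-side (inj₂ (B₁ , e₁ , _)) = by-level (level w)
          where
            lB≡ : length B ≡ dq w
            lB≡ = proj₁ (geodesic-to-q P-v B₁ w B e₁)
            w⇝q′ : ReachWithin Stage1 w q (dq w)
            w⇝q′ = subst (ReachWithin Stage1 w q) lB≡ w⇝q
            total′ : length A + dq w ≤ 8
            total′ = subst (λ k → length A + k ≤ 8) lB≡ total
            by-level : Level (dp w) (dq w) → Bounded Stage1 w
            by-level (ascending e↑) =
              ⊥-elim (1+n≰n (subst (_≤ dp w) e↑ (suffix-nonascending P-v v-nonascending B₁ w B e₁)))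
            by-level (descending e↓) =
              bounded (descending e↓) (descending-bounds e↓ (DDistLe-weaken (m≤m+n _ 2) p⇝w) w⇝q′ total′)
            by-level (flat e→) with flat⇒2⊎≥3 e→
            ... | inj₁ two = S₂₂ two (trans e→ two)
            ... | inj₂ w≥3 = bounded (flat e→) (flat-bounds-≥3 e→ w≥3 p⇝w w⇝q′ total′)

  S₂₂-neighbour-of-p : ∀ {w a} → dq w ≡ 2 → Adj G a w → dp a ≡ 1 → dq a ≡ 2
  S₂₂-neighbour-of-p {w} {a} eq aw dpa with level a
  ... | ascending e  = trans e (cong suc dpa)
  ... | flat e       = ⊥-elim (S₁₁-empty dpa (trans e dpa))
  ... | descending e = ⊥-elim (1+n≰n (subst₂ _≤_ eq (cong suc (suc-injective (trans (sym e) dpa))) (d-adj-step q aw)))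

  -- w ∈ S_{2,2} lies on the Stage-1 path p a w b q through the vertical edge aw, where a ∈ S_{1,2}.
  S₂₂-reach : ∀ {w} → dp w ≡ 2 → dq w ≡ 2 → ReachWithin Stage1 p w 2 × ReachWithin Stage1 w q 2
  S₂₂-reach {w} ep eq with d≡2⇒middle ep | d≡2⇒middle eq
  ... | a , wa , ap | b , wb , bq
    with walk-split (Stage1Path.walk vertical a↑ (inj₁ w→) P-a P-w aw≢pq) (p ∷ a ∷ []) w (b ∷ q ∷ []) refl
    where
      dpa : dp a ≡ 1
      dpa = d-middle wa ap ep
      a↑ : HasLevel a 1ℤ
      a↑ = ascending⇒HasLevel (trans (S₂₂-neighbour-of-p eq (Adj-sym wa) dpa) (cong suc (sym dpa)))
      w→ : HasLevel w 0ℤ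
      w→ = flat⇒HasLevel (trans eq (sym ep))
      vertical : Vertical a w
      vertical = Adj-sym wa , 1ℤ , 0ℤ , a↑ , w→ , +<+ (s≤s z≤n)
      P-a : ShortestPath G p (a ∷ []) a
      P-a = walk⇒ShortestPath (a ∷ []) (step (Adj-sym ap) done) (sym (trans (d-sym p a) dpa))
      P-w : ShortestPath G w (b ∷ q ∷ []) q
      P-w = walk⇒ShortestPath (b ∷ q ∷ []) (step wb (step bq done)) (sym eq)
      aw≢pq : ¬ (a ≡ p × w ≡ q)
      aw≢pq (a≡p , _) = 1+n≢0 (trans (sym dpa) (trans (cong dp a≡p) dp-p))
  ... | (_ , walk-pw , lA) , walk-wq = DDistLe-walk walk-pw (≤-reflexive lA) , DDistLe-walk walk-wq ≤-refl

  S₂₂-bounded : ∀ {w} → dp w ≡ 2 → dq w ≡ 2 → Bounded Stage1 w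
  S₂₂-bounded {w} ep eq with S₂₂-reach ep eq
  ... | p⇝w , w⇝q =
    bounded (flat e) (flat-bounds e p⇝w w⇝q (m≤n+m 2 (dp w)) (subst (λ k → 2 + k ≤ 8) (sym ep) (m≤m+n 4 4)))
    where
      e : dq w ≡ dp w
      e = trans eq (sym ep)

  first-descent : ∀ {x ys} → dq x ≡ suc (dp x) → WalkL (AdjMinus G p q) x ys q →
                  Σ V λ u → Σ V λ v → AdjMinus G p q u v × dq u ≡ suc (dp u)
                                    × (dq v ≡ dp v ⊎ dp v ≡ suc (dq v))
  first-descent e done = ⊥-elim (0≢1+n (trans (sym dq-q) e))
  first-descent {x} e (step {y = y} a w) with level y
  ... | ascending e′  = first-descent e′ w
  ... | flat e′       = x , y , a , e , inj₁ e′
  ... | descending e′ = x , y , a , e , inj₂ e′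

  p-ascending : dq p ≡ suc (dp p)
  p-ascending = trans dq-p (cong suc (sym dp-p))

  q-descending : dp q ≡ suc (dq q)
  q-descending = trans dp-q (cong suc (sym dq-q))

  descent-vertical : ∀ {u v} → Adj G u v → dq u ≡ suc (dp u) → dq v ≡ dp v ⊎ dp v ≡ suc (dq v) →
                     Vertical u v × (HasLevel v 0ℤ ⊎ HasLevel v -1ℤ)
  descent-vertical uv u↑ (inj₁ e) =
    (uv , 1ℤ , 0ℤ , ascending⇒HasLevel u↑ , flat⇒HasLevel e , +<+ (s≤s z≤n)) , inj₁ (flat⇒HasLevel e)
  descent-vertical uv u↑ (inj₂ e) =
    (uv , 1ℤ , -1ℤ , ascending⇒HasLevel u↑ , descending⇒HasLevel e , -<+) , inj₂ (descending⇒HasLevel e)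

  p⇝q : ReachWithin Stage1 p q 8
  p⇝q with first-descent p-ascending (proj₂ (proj₂ two-edge-connected p q pq p q))
  ... | u , v , (uv , ¬pq) , u↑ , v-level with descent-vertical uv u↑ v-level | geodesic p u | geodesic v q
  ...   | vertical , v-level′ | us , walk-u , lu | vs , walk-v , lv =
    DDistLe-walk (walk (λ e → ¬pq (inj₁ e))) path-length
    where
      open Stage1Path vertical (ascending⇒HasLevel u↑) v-level′
                      (walk⇒ShortestPath us walk-u lu) (walk⇒ShortestPath vs walk-v lv)

  p-bounded : Bounded Stage1 p
  p-bounded = bounded (ascending p-ascending)
    (ascending-bounds p-ascending (subst (ReachWithin Stage1 p p) (sym dp-p) DDistLe-refl) p⇝q
                      (≤-reflexive (trans (cong (8 +_) dp-p) (+-identityʳ 8))))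

  q-bounded : Bounded Stage1 q
  q-bounded = bounded (descending q-descending)
    (descending-bounds q-descending (DDistLe-weaken (m≤m+n 8 2) p⇝q)
                       (subst (ReachWithin Stage1 q q) (sym dq-q) DDistLe-refl)
                       (≤-reflexive (trans (cong (8 +_) dq-q) (+-identityʳ 8))))

  Invariant : Arcs → Set
  Invariant H = ∀ w → VH H w → Bounded H w

  Stage1-bounded : ∀ {u v us vs} → Vertical u v → HasLevel u 1ℤ → HasLevel v 0ℤ ⊎ HasLevel v -1ℤ →
                   ShortestPath G p us u → ShortestPath G v vs q →
                   ∀ A w B → (p ∷ us) ++ (v ∷ vs) ≡ A ++ w ∷ B → Bounded Stage1 w
  Stage1-bounded {u} {v} vertical u-level v-level P-u P-v A w B e = by-degeneracy (u Fin.≟ p) (v Fin.≟ q)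
    where
      open Stage1Path vertical u-level v-level P-u P-v
      by-degeneracy : Dec (u ≡ p) → Dec (v ≡ q) → Bounded Stage1 w
      by-degeneracy (yes u≡p) (yes v≡q) =
        [ (λ w≡p → subst (Bounded Stage1) (sym w≡p) p-bounded)
        , (λ w≡q → subst (Bounded Stage1) (sym w≡q) q-bounded) ]
          (degenerate-vertex u≡p v≡q A w B e)
      by-degeneracy (no u≢p) _        = bounded-on-path (λ (u≡p , _) → u≢p u≡p) S₂₂-bounded A w B e
      by-degeneracy (yes _)  (no v≢q) = bounded-on-path (λ (_ , v≡q) → v≢q v≡q) S₂₂-bounded A w B e

  Stage1-invariant : Invariant Stage1
  Stage1-invariant w (y , inj₁ (_ , _ , _ , _ , vertical , u-level , v-level , P-u , P-v , c))
    with consec-occurrence (inj₁ c)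
  ... | A , B , e = Stage1-bounded vertical u-level v-level P-u P-v A w B e
  Stage1-invariant w (y , inj₂ (_ , _ , _ , _ , vertical , u-level , v-level , P-u , P-v , c))
    with consec-occurrence (inj₂ c)
  ... | A , B , e = Stage1-bounded vertical u-level v-level P-u P-v A w B e

  module Stage2Step {H : Arcs} (invariant : Invariant H) {u v us vs}
                    (vertical : Vertical u v) (u-level : HasLevel u 0ℤ) (v-level : HasLevel v -1ℤ)
                    (P-u : ShortestPath G p us u) (P-v : ShortestPath G v vs q)
                    {A x B C y D} (eA : p ∷ us ≡ A ++ x ∷ B) (x∈H : VH H x)
                    (eC : v ∷ vs ≡ C ++ y ∷ D) (y∈H : VH H y)
                    where

    seg : List V
    seg = x ∷ (B ++ (C ++ y ∷ []))

    H′ : Arcs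
    H′ a b = H a b ⊎ Consec seg a b

    u-flat : dq u ≡ dp u
    u-flat = HasLevel-flat u-level

    v-descending : dp v ≡ suc (dq v)
    v-descending = HasLevel-descending v-level

    u-nondescending : dp u ≤ dq u
    u-nondescending = ≤-reflexive (sym u-flat)

    path-eq : (p ∷ us) ++ (v ∷ vs) ≡ A ++ (seg ++ D)
    path-eq = begin
      (p ∷ us) ++ (v ∷ vs)                      ≡⟨ cong₂ _++_ eA eC ⟩
      (A ++ x ∷ B) ++ (C ++ y ∷ D)              ≡⟨ ++-assoc A (x ∷ B) (C ++ y ∷ D) ⟩
      A ++ x ∷ (B ++ (C ++ y ∷ D))              ≡⟨ cong (λ L → A ++ x ∷ (B ++ L)) (sym (++-assoc C (y ∷ []) D)) ⟩
      A ++ x ∷ (B ++ ((C ++ y ∷ []) ++ D))      ≡⟨ cong (λ L → A ++ x ∷ L) (sym (++-assoc B (C ++ y ∷ []) D)) ⟩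
      A ++ (seg ++ D)                           ∎
      where open ≡-Reasoning

    path-length : length (us ++ v ∷ vs) ≤ 8
    path-length = subst (_≤ 8) (sym (length-++ us)) (+-mono-≤ us≤4 (s≤s vs≤3))
      where
        us≤4 : length us ≤ 4
        us≤4 = subst (_≤ 4) (sym (trans (ShortestPath-length P-u) (d-sym p u))) (d≤4 u p)
        vs≤3 : length vs ≤ 3
        vs≤3 = subst (_≤ 3) (sym (ShortestPath-length P-v)) (≤-pred (subst (_≤ 4) v-descending (d≤4 v p)))

    seg-walk : Walk x (B ++ (C ++ y ∷ [])) y
    seg-walk = walk-++ (proj₂ (walk-split (proj₁ P-u) A x B eA)) (walk-cons-take (proj₁ vertical) (proj₁ P-v) C y D eC)

    new-walk : WalkL (WithoutPQ H′) x (B ++ (C ++ y ∷ [])) y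
    new-walk = walk-consec seg-walk
      λ c → inj₂ c , λ (a≡p , b≡q) → u≢p (proj₁ (on-path (subst₂ (Consec seg) a≡p b≡q c)))
      where
        on-path : Consec seg p q → u ≡ p × v ≡ q
        on-path c = pq-arc⇒middle P-u u-nondescending P-v (subst (dq v ≤_) (sym v-descending) (n≤1+n (dq v)))
                      (subst (λ L → Consec L p q) (sym path-eq) (consec-++ˡ A (consec-++ʳ D c)))
        u≢p : u ≢ p
        u≢p u≡p = 1+n≢0 (trans (sym dq-p) (trans (cong dq (sym u≡p)) (trans u-flat (trans (cong dp u≡p) dp-p))))

    x-nondescending : dp x ≤ dq x
    x-nondescending = prefix-nondescending P-u u-nondescending A x B eA

    x-reach : Level (dp x) (dq x) → ReachWithin H p x (dp x + 2)
    x-reach (ascending e)  = DDistLe-weaken (m≤m+n (dp x) 2) (proj₁ (invariant x x∈H (ascending e)))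
    x-reach (flat e)       = proj₁ (invariant x x∈H (flat e))
    x-reach (descending e) = ⊥-elim (1+n≰n (subst (_≤ dq x) e x-nondescending))

    y-reach : ReachWithin H y q (dq y)
    y-reach = proj₂ (invariant y y∈H (descending (suffix-descending P-v v-descending C y D eC)))

    module Occurrence (E : List V) (w : V) (F : List V) (e : seg ≡ E ++ w ∷ F) where

      path-eq′ : (p ∷ us) ++ (v ∷ vs) ≡ (A ++ E) ++ w ∷ (F ++ D)
      path-eq′ = trans path-eq (trans (cong (λ L → A ++ (L ++ D)) e)
                   (trans (cong (A ++_) (++-assoc E (w ∷ F) D)) (sym (++-assoc A E (w ∷ F ++ D)))))

      total : length (A ++ E) + length (F ++ D) ≤ 8
      total = subst (_≤ 8) (length-split p (us ++ v ∷ vs) (A ++ E) w (F ++ D) path-eq′) path-length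

      lAE : length (A ++ E) ≡ dp x + length E
      lAE = trans (length-++ A) (cong (_+ length E) (proj₁ (geodesic-from-p P-u A x B eA)))

      via-x : ∀ {k} → ReachWithin H p x k → ReachWithin H′ p w (k + length E)
      via-x p⇝x with walk-split new-walk E w F e
      ... | (_ , walk-xw , lE) , _ = DDistLe-trans (ReachWithin-mono inj₁ p⇝x) (DDistLe-walk walk-xw (≤-reflexive lE))

      p⇝w : ReachWithin H′ p w (length (A ++ E) + 2)
      p⇝w = subst (ReachWithin H′ p w) (trans (+-swap-2 (dp x) (length E)) (cong (_+ 2) (sym lAE)))
                  (via-x (x-reach (level x)))
        where
          +-swap-2 : ∀ a b → a + 2 + b ≡ a + b + 2
          +-swap-2 = solve-∀

      w⇝q : ReachWithin H′ w q (length (F ++ D))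
      w⇝q = subst (ReachWithin H′ w q)
                  (trans (cong (length F +_) (sym (proj₁ (geodesic-to-q P-v C y D eC)))) (sym (length-++ F)))
              (DDistLe-trans (DDistLe-walk (proj₂ (walk-split new-walk E w F e)) ≤-refl) (ReachWithin-mono inj₁ y-reach))

      d-x-w : d x w ≤ length E
      d-x-w with walk-split seg-walk E w F e
      ... | (_ , walk-xw , lE) , _ = subst (d x w ≤_) lE (d≤length walk-xw)

      bounded-before-u : ∀ A₂ → p ∷ us ≡ (A ++ E) ++ w ∷ A₂ → Bounded H′ w
      bounded-before-u A₂ e₁ = by-level (level w)
        where
          lAE≡ : length (A ++ E) ≡ dp w
          lAE≡ = proj₁ (geodesic-from-p P-u (A ++ E) w A₂ e₁)
          total′ : length (F ++ D) + dp w ≤ 8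
          total′ = subst (_≤ 8) (trans (+-comm (length (A ++ E)) _) (cong (length (F ++ D) +_) lAE≡)) total
          x-ascending : dq w ≡ suc (dp w) → dq x ≡ suc (dp x)
          x-ascending e↑ with level x
          ... | ascending e  = e
          ... | descending e = ⊥-elim (1+n≰n (subst (_≤ dq x) e x-nondescending))
          ... | flat e       = ⊥-elim (1+n≰n (≤-trans (≤-reflexive (sym e↑)) (begin
            dq w            ≤⟨ d-triangle w x q ⟩
            d w x + dq x    ≡⟨ cong₂ _+_ (d-sym w x) e ⟩
            d x w + dp x    ≤⟨ +-monoˡ-≤ (dp x) d-x-w ⟩
            length E + dp x ≡⟨ trans (+-comm (length E) (dp x)) (trans (sym lAE) lAE≡) ⟩
            dp w            ∎)))
            where open ≤-Reasoning
          by-level : Level (dp w) (dq w) → Bounded H′ w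
          by-level (ascending e↑) = bounded (ascending e↑) (ascending-bounds e↑ p⇝w-exact w⇝q total′)
            where
              p⇝w-exact : ReachWithin H′ p w (dp w)
              p⇝w-exact = subst (ReachWithin H′ p w) (trans (sym lAE) lAE≡)
                                (via-x (proj₁ (invariant x x∈H (ascending (x-ascending e↑)))))
          by-level (flat e→) =
            bounded (flat e→) (flat-bounds e→ p⇝w w⇝q (≤-reflexive (cong (_+ 2) lAE≡)) total′)
          by-level (descending e↓) =
            ⊥-elim (1+n≰n (subst (_≤ dq w) e↓ (prefix-nondescending P-u u-nondescending (A ++ E) w A₂ e₁)))

      bounded-after-v : ∀ B₁ → v ∷ vs ≡ B₁ ++ w ∷ (F ++ D) → Bounded H′ w
      bounded-after-v B₁ e₁ =
        bounded (descending w↓) (descending-bounds w↓ p⇝w (subst (ReachWithin H′ w q) lFD≡ w⇝q)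
                                                      (subst (λ k → length (A ++ E) + k ≤ 8) lFD≡ total))
        where
          w↓ : dp w ≡ suc (dq w)
          w↓ = suffix-descending P-v v-descending B₁ w (F ++ D) e₁
          lFD≡ : length (F ++ D) ≡ dq w
          lFD≡ = proj₁ (geodesic-to-q P-v B₁ w (F ++ D) e₁)

      bounded-on-segment : Bounded H′ w
      bounded-on-segment with ++-split (p ∷ us) (v ∷ vs) (A ++ E) w (F ++ D) path-eq′
      ... | inj₁ (A₂ , e₁ , _) = bounded-before-u A₂ e₁
      ... | inj₂ (B₁ , e₁ , _) = bounded-after-v B₁ e₁

    invariant′ : Invariant H′
    invariant′ w (z , inj₁ (inj₁ h)) = Bounded-mono inj₁ (invariant w (z , inj₁ h))
    invariant′ w (z , inj₂ (inj₁ h)) = Bounded-mono inj₁ (invariant w (z , inj₂ h))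
    invariant′ w (z , inj₁ (inj₂ c)) with consec-occurrence (inj₁ c)
    ... | E , F , e = Occurrence.bounded-on-segment E w F e
    invariant′ w (z , inj₂ (inj₂ c)) with consec-occurrence (inj₂ c)
    ... | E , F , e = Occurrence.bounded-on-segment E w F e

  Stage2-invariant : ∀ {H cs H₂} → Stage1 ⇒ H → Invariant H → All Qualifying cs → Run2 H cs H₂ →
                     Stage1 ⇒ H₂ × Invariant H₂
  Stage2-invariant stage1⊆ invariant [] run-nil = stage1⊆ , invariant
  Stage2-invariant stage1⊆ invariant ((vertical , u-level , v-level , _ , _ , P-u , P-v) ∷ qualifying)
                   (run-cons (_ , _ , _ , _ , _ , _ , eA , x∈H , _ , eC , y∈H , _ , refl) run) =
    Stage2-invariant (λ h → inj₁ (stage1⊆ h)) invariant′ qualifying run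
    where open Stage2Step invariant vertical u-level v-level P-u P-v eA x∈H eC y∈H

  module Output {cs H₂} (enumerates : Enumerates cs) (run : Run2 Stage1 cs H₂) where

    H₁ : Arcs
    H₁ = Stage3 H₂

    stage1⊆H₂×invariant₂ : Stage1 ⇒ H₂ × Invariant H₂
    stage1⊆H₂×invariant₂ = Stage2-invariant (λ h → h) Stage1-invariant (proj₁ enumerates) run

    stage1⊆H₂ : Stage1 ⇒ H₂
    stage1⊆H₂ = proj₁ stage1⊆H₂×invariant₂

    invariant₂ : Invariant H₂
    invariant₂ = proj₂ stage1⊆H₂×invariant₂

    reach : ∀ {x y k} → ReachWithin H₂ x y k → DDistLe H₁ x y k
    reach = DDistLe-mono inj₁

    bounded₁ : ∀ w → VH H₁ w → Bounded H₂ w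
    bounded₁ w (z , inj₁ (inj₁ (h , _)))     = invariant₂ w (z , inj₁ h)
    bounded₁ w (z , inj₂ (inj₁ (h , _)))     = invariant₂ w (z , inj₂ h)
    bounded₁ w (z , inj₁ (inj₂ (refl , _))) = Bounded-mono stage1⊆H₂ q-bounded
    bounded₁ w (z , inj₂ (inj₂ (_ , refl))) = Bounded-mono stage1⊆H₂ p-bounded

    class-bounds : ∀ {i j w} → VH H₁ w → InS i j w → (l : Level i j) →
                   DDistLe H₁ p w (fromP-budget l) × DDistLe H₁ w q (toQ-budget l)
    class-bounds {w = w} w∈H₁ s l with InS⇒≡ s
    ... | refl , refl = reach (proj₁ (bounded₁ w w∈H₁ l)) , reach (proj₂ (bounded₁ w w∈H₁ l))

    S₂₂-bounds : ∀ {w} → InS 2 2 w → DDistLe H₁ p w 2 × DDistLe H₁ w q 2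
    S₂₂-bounds s with InS⇒≡ s
    ... | ep , eq with S₂₂-reach (sym ep) (sym eq)
    ...   | p⇝w , w⇝q = reach (ReachWithin-mono stage1⊆H₂ p⇝w) , reach (ReachWithin-mono stage1⊆H₂ w⇝q)

    to-q : ∀ {x} → VH H₁ x → x ≢ p → DDistLe H₁ x q 7
    to-q {x} x∈H₁ x≢p with level x
    ... | ascending e  = DDistLe-weaken (∸-monoʳ-≤ 8 (≢⇒d≥1 x≢p))
                                        (reach (proj₂ (bounded₁ x x∈H₁ (ascending e))))
    ... | flat e       = DDistLe-weaken (∸-monoʳ-≤ 8 (≢⇒d≥1 x≢p))
                                        (reach (proj₂ (bounded₁ x x∈H₁ (flat e))))
    ... | descending e = DDistLe-weaken (m≤n⇒m≤o+n 4 (≤-pred (subst (_≤ 4) e (d≤4 x p))))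
                                        (reach (proj₂ (bounded₁ x x∈H₁ (descending e))))

    from-p : ∀ {y} → VH H₁ y → y ≢ q → DDistLe H₁ p y 9
    from-p {y} y∈H₁ y≢q with level y
    ... | ascending e  = DDistLe-weaken (m≤n⇒m≤o+n 6 (≤-pred (subst (_≤ 4) e (d≤4 y q))))
                                        (reach (proj₁ (bounded₁ y y∈H₁ (ascending e))))
    ... | flat e       = DDistLe-weaken (m≤n⇒m≤o+n 3 (+-monoˡ-≤ 2 (d≤4 y p)))
                                        (reach (proj₁ (bounded₁ y y∈H₁ (flat e))))
    ... | descending e = DDistLe-weaken (∸-monoʳ-≤ 10 (≢⇒d≥1 y≢q))
                                        (reach (proj₁ (bounded₁ y y∈H₁ (descending e))))

    p⇝q₁ : DDistLe H₁ p q 10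
    p⇝q₁ = subst (DDistLe H₁ p q) (cong (10 ∸_) dq-q)
                 (reach (proj₁ (Bounded-mono stage1⊆H₂ q-bounded (descending q-descending))))

    q→p : DDistLe H₁ q p 1
    q→p = DDistLe-walk (step (inj₂ (refl , refl)) done) ≤-refl

    diameter-≤17 : ∀ x y → VH H₁ x → VH H₁ y → DDistLe H₁ x y 17
    diameter-≤17 x y x∈H₁ y∈H₁ with x Fin.≟ p | y Fin.≟ q
    ... | yes refl | yes refl = DDistLe-weaken (m≤m+n 10 7) p⇝q₁
    ... | yes refl | no y≢q   = DDistLe-weaken (m≤m+n 9 8) (from-p y∈H₁ y≢q)
    ... | no x≢p   | yes refl = DDistLe-weaken (m≤m+n 7 10) (to-q x∈H₁ x≢p)
    ... | no x≢p   | no y≢q   = DDistLe-trans (DDistLe-trans (to-q x∈H₁ x≢p) q→p) (from-p y∈H₁ y≢q)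

corollary2 : (G : Graph) (p q : Vertex G) →
    TwoEdgeConnected G → Diameter G 4 → Adj G p q →
    ¬ EdgeInC3 G p q → ¬ EdgeInC4 G p q →
    let open OrientedCore G p q in
    (cs : List Cand) (H₂ : Arcs) → Enumerates cs → Run2 Stage1 cs H₂ →
    let H₁ = Stage3 H₂ in
    (∀ x y → VH H₁ x → VH H₁ y → DDistLe H₁ x y 17)
    × (∀ w → VH H₁ w →
        (InS 1 2 w → DDistLe H₁ p w 1 × DDistLe H₁ w q 7)
      × (InS 2 3 w → DDistLe H₁ p w 2 × DDistLe H₁ w q 6)
      × (InS 3 4 w → DDistLe H₁ p w 3 × DDistLe H₁ w q 5)
      × (InS 2 2 w → DDistLe H₁ p w 2 × DDistLe H₁ w q 2)
      × (InS 3 3 w → DDistLe H₁ p w 5 × DDistLe H₁ w q 5)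
      × (InS 4 4 w → DDistLe H₁ p w 6 × DDistLe H₁ w q 4)
      × (InS 2 1 w → DDistLe H₁ p w 9 × DDistLe H₁ w q 1)
      × (InS 3 2 w → DDistLe H₁ p w 8 × DDistLe H₁ w q 2)
      × (InS 4 3 w → DDistLe H₁ p w 7 × DDistLe H₁ w q 3))
corollary2 G p q two-edge-connected diam pq no-C3 _ cs H₂ enumerates run =
  diameter-≤17 , λ w w∈H₁ →
    (λ s → class-bounds w∈H₁ s (ascending refl)) ,
    (λ s → class-bounds w∈H₁ s (ascending refl)) ,
    (λ s → class-bounds w∈H₁ s (ascending refl)) ,
    S₂₂-bounds ,
    (λ s → class-bounds w∈H₁ s (flat refl)) ,
    (λ s → class-bounds w∈H₁ s (flat refl)) ,
    (λ s → class-bounds w∈H₁ s (descending refl)) ,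
    (λ s → class-bounds w∈H₁ s (descending refl)) ,
    (λ s → class-bounds w∈H₁ s (descending refl))
  where
    open CoreBounds G p q two-edge-connected diam pq no-C3
    open Levels G dist p q pq using (ascending; flat; descending)
    open Output enumerates run
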